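{- Let $g:\{ -1,1\}^k\to\{ -1,1\}$ and $\alpha\in[-1,1]^k$. Let $\mathbf z\in\{0,1\}^k$ have independent coordinates $\mathbf z_i\sim\mathrm{Ber}(\alpha_i^2)$. Then $\mathbb E_{\mathbf z}[\mathrm{error}_{\mathbf z}(g)]\le 2\cdot\mathrm{error}_\alpha(g)$.
   Context: For $\beta\in[-1,1]^k$, $\mathcal D(\beta)$ is the distribution of $(\mathbf x,\mathbf y)$ on $\{ -1,1\}^k\times\{ -1,1\}^k$ with $\mathbf x$ uniform and, independently for each $i$, $\mathbf y_i=\mathbf x_i$ with probability $(1+\beta_i)/2$ and $\mathbf y_i=-\mathbf x_i$ otherwise. The $\beta$-correlated error is $\mathrm{error}_\beta(g)=\min_{h:\{ -1,1\}^k\to\{ -1,1\}}\Pr_{(\mathbf x,\mathbf y)\sim\mathcal D(\beta)}[g(\mathbf y)\ne h(\mathbf x)]$. $\mathrm{Ber}(p)$ is the Bernoulli distribution taking value $1$ with probability $p$. -}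

module Defs where

open import Level using (Level; _⊔_) renaming (suc to lsuc)
open import Algebra.Bundles using (CommutativeRing)
open import Relation.Binary.Core using (Rel)
open import Relation.Binary.Structures using (IsTotalOrder)
open import Relation.Nullary using (¬_)
open import Data.Nat using (ℕ; zero; suc)
open import Data.Bool using (Bool; true; false; if_then_else_; _xor_)
open import Data.Vec using (Vec; []; _∷_)
open import Data.Product using () renaming (Σ to Σ'; _×_ to _×'_)
open import Data.List using (List; []; _∷_; map; _++_)

-- An ordered field (ℝ is an instance).  Field inverse is total with
-- 0⁻¹ unconstrained, as usual.
record OrderedField c ℓ₁ ℓ₂ : Set (lsuc (c ⊔ ℓ₁ ⊔ ℓ₂)) where
  field
    commutativeRing : CommutativeRing c ℓ₁
  open CommutativeRing commutativeRing public
  field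
    _≤_          : Rel Carrier ℓ₂
    isTotalOrder : IsTotalOrder _≈_ _≤_
    +-monoʳ-≤ord : ∀ z {x y} → x ≤ y → (x + z) ≤ (y + z)
    *-nonneg     : ∀ {x y} → 0# ≤ x → 0# ≤ y → 0# ≤ (x * y)
    0≉1          : ¬ (0# ≈ 1#)
    _⁻¹          : Carrier → Carrier
    ⁻¹-inverse   : ∀ x → ¬ (x ≈ 0#) → (x * (x ⁻¹)) ≈ 1#

-- All points of {-1,1}^k (true = 1, false = -1), also used for {0,1}^k
-- (true = 1, false = 0).
allVecs : (k : ℕ) → List (Vec Bool k)
allVecs zero    = [] ∷ []
allVecs (suc k) = map (true ∷_) (allVecs k) ++ map (false ∷_) (allVecs k)

module Prob {c ℓ₁ ℓ₂} (F : OrderedField c ℓ₁ ℓ₂) where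
  open OrderedField F

  ½ : Carrier
  ½ = (1# + 1#) ⁻¹

  sumL : List Carrier → Carrier
  sumL []       = 0#
  sumL (a ∷ as) = a + sumL as

  Σ[_] : (k : ℕ) → (Vec Bool k → Carrier) → Carrier
  Σ[ k ] f = sumL (map f (allVecs k))

  -- Pr_{D(β)}[x, y] : x uniform, y_i = x_i w.p. (1+β_i)/2, else -x_i.
  jointProb : ∀ {k} → Vec Carrier k → Vec Bool k → Vec Bool k → Carrier
  jointProb []       []       []       = 1#
  jointProb (b ∷ β) (xi ∷ x) (yi ∷ y) =
    (½ * (if xi xor yi then ((1# - b) * ½) else ((1# + b) * ½)))
      * jointProb β x y

  indicator : Bool → Carrier
  indicator true  = 1#
  indicator false = 0#

  disagree : ∀ {k} → Vec Carrier k → (Vec Bool k → Bool) → (Vec Bool k → Bool) → Carrier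
  disagree {k} β g h =
    Σ[ k ] (λ x → Σ[ k ] (λ y → jointProb β x y * indicator (g y xor h x)))

  IsError : ∀ {k} → Vec Carrier k → (Vec Bool k → Bool) → Carrier → Set (ℓ₁ ⊔ ℓ₂)
  IsError {k} β g e =
    (Σ' (Vec Bool k → Bool) (λ h → e ≈ disagree β g h))
    ×' (∀ (h : Vec Bool k → Bool) → e ≤ disagree β g h)

  toVec : ∀ {k} → Vec Bool k → Vec Carrier k
  toVec []       = []
  toVec (b ∷ z) = (if b then 1# else 0#) ∷ toVec z

  berProb : ∀ {k} → Vec Carrier k → Vec Bool k → Carrier
  berProb []       []       = 1#
  berProb (a ∷ α) (b ∷ z) =
    (if b then (a * a) else (1# - (a * a))) * berProb α z

module Submission where

-- For z ∈ {0,1}^k, a sample (x, y) of D(z) has y_i = x_i where z_i = 1 and y_i uniform and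
-- independent of x elsewhere.  Hence for every u the hypothesis x ↦ g(mix z x u), which reads x_i
-- where z_i = 1 and u_i elsewhere, errs with probability at least error_z(g).  Averaging over
-- z_i ∼ Ber(α_i²) and uniform u, the pair (y, mix z x u) has the law of two independent
-- α-correlated copies (y, y′) of one uniform x: in both, the i-th coordinates agree with
-- probability (1 + α_i²)/2.  So E_z[error_z(g)] ≤ Pr[g(y) ≠ g(y′)] ≤ Pr[g(y) ≠ h(x)] +
-- Pr[g(y′) ≠ h(x)] = 2 error_α(g) for an optimal h.  All laws involved are product measures, so
-- the equalities of laws reduce to one coordinate, where they are polynomial identities.

open import Defs
open import Level using (0ℓ)
open import Algebra.Bundles using (CommutativeRing)
open import Algebra.Bundles.Raw using (RawRing)
open import Data.Bool using (Bool; true; false; if_then_else_; _xor_)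
open import Data.Fin as Fin using (Fin)
open import Data.Integer as ℤ using (ℤ; +_; -[1+_]; _⊖_)
import Data.Integer.Properties as ℤ
open import Data.List as List using (List; []; _∷_; _++_; cartesianProduct)
open import Data.Maybe using (Maybe; just; nothing)
open import Data.Nat as ℕ using (ℕ; zero; suc)
import Data.Nat.Properties as ℕ
open import Data.Product using (_×_; _,_; proj₁; proj₂)
import Data.Sign as Sign
open import Data.Sum using (_⊎_; inj₁; inj₂)
open import Data.Vec as Vec using (Vec; []; _∷_; lookup)
open import Data.Vec.Properties using (map-id; map-∘; map-cong)
open import Function using (id)
open import Relation.Binary.Bundles using (Poset)
open import Relation.Binary.PropositionalEquality as ≡ using (_≡_)
open import Relation.Binary.Structures using (IsTotalOrder)
open import Relation.Nullary using (¬_; yes; no)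

module IntegerCoefficients {c ℓ} (R : CommutativeRing c ℓ) where
  open CommutativeRing R hiding (zero)
  open import Algebra.Properties.Ring ring using (-‿distribˡ-*; -‿distribʳ-*; -‿involutive; -0#≈0#)
  open import Algebra.Properties.AbelianGroup +-abelianGroup using (⁻¹-∙-comm)
  open import Algebra.Properties.Semiring.Mult.TCOptimised semiring
    using (×1-homo-*; ×-homo-+; 1+×) renaming (_×_ to _×ₙ_)
  open import Relation.Binary.Reasoning.Setoid setoid
  import Algebra.Solver.Ring.AlmostCommutativeRing as ACR

  -- With the type-checking-optimised multiple, fromℤ (+ 0) and fromℤ (+ 1) reduce to 0# and 1#,
  -- so evaluated polynomials match hand-written goals definitionally.
  fromℤ : ℤ → Carrier
  fromℤ (+ n)    = n ×ₙ 1#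
  fromℤ -[1+ n ] = - (suc n ×ₙ 1#)

  fromℤ-neg : ∀ i → fromℤ (ℤ.- i) ≈ - fromℤ i
  fromℤ-neg (+ zero)  = sym -0#≈0#
  fromℤ-neg (+ suc n) = refl
  fromℤ-neg -[1+ n ]  = sym (-‿involutive _)

  fromℤ-⊖ : ∀ m n → fromℤ (m ⊖ n) ≈ m ×ₙ 1# - n ×ₙ 1#
  fromℤ-⊖ m zero = begin
    fromℤ (m ⊖ zero)  ≡⟨ ≡.cong fromℤ (ℤ.⊖-≥ {m} ℕ.z≤n) ⟩
    m ×ₙ 1#           ≈⟨ +-identityʳ _ ⟨
    m ×ₙ 1# + 0#      ≈⟨ +-congˡ -0#≈0# ⟨
    m ×ₙ 1# - 0#      ∎
  fromℤ-⊖ zero (suc n) = begin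
    fromℤ (zero ⊖ suc n)  ≡⟨ ≡.cong fromℤ (ℤ.⊖-< {zero} {suc n} (ℕ.s≤s ℕ.z≤n)) ⟩
    fromℤ (ℤ.- + suc n)   ≈⟨ fromℤ-neg (+ suc n) ⟩
    - (suc n ×ₙ 1#)       ≈⟨ +-identityˡ _ ⟨
    0# - suc n ×ₙ 1#      ∎
  fromℤ-⊖ (suc m) (suc n) = begin
    fromℤ (suc m ⊖ suc n)              ≡⟨ ≡.cong fromℤ (ℤ.[1+m]⊖[1+n]≡m⊖n m n) ⟩
    fromℤ (m ⊖ n)                      ≈⟨ fromℤ-⊖ m n ⟩
    m ×ₙ 1# - n ×ₙ 1#                  ≈⟨ [x+a]-[x+b]≈a-b 1# (m ×ₙ 1#) (n ×ₙ 1#) ⟨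
    (1# + m ×ₙ 1#) - (1# + n ×ₙ 1#)    ≈⟨ +-cong (1+× m 1#) (-‿cong (1+× n 1#)) ⟨
    suc m ×ₙ 1# - suc n ×ₙ 1#          ∎
    where
    [x+a]-[x+b]≈a-b : ∀ x a b → (x + a) - (x + b) ≈ a - b
    [x+a]-[x+b]≈a-b x a b = begin
      (x + a) + - (x + b)     ≈⟨ +-congˡ (⁻¹-∙-comm x b) ⟨
      (x + a) + (- x + - b)   ≈⟨ +-congʳ (+-comm x a) ⟩
      (a + x) + (- x + - b)   ≈⟨ +-assoc a x _ ⟩
      a + (x + (- x + - b))   ≈⟨ +-congˡ (+-assoc x (- x) (- b)) ⟨
      a + ((x + - x) + - b)   ≈⟨ +-congˡ (+-congʳ (-‿inverseʳ x)) ⟩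
      a + (0# + - b)          ≈⟨ +-congˡ (+-identityˡ _) ⟩
      a - b                   ∎

  fromℤ-+ : ∀ i j → fromℤ (i ℤ.+ j) ≈ fromℤ i + fromℤ j
  fromℤ-+ (+ m)    (+ n)    = ×-homo-+ 1# m n
  fromℤ-+ (+ m)    -[1+ n ] = fromℤ-⊖ m (suc n)
  fromℤ-+ -[1+ m ] (+ n)    = trans (fromℤ-⊖ n (suc m)) (+-comm _ _)
  fromℤ-+ -[1+ m ] -[1+ n ] = begin
    - (suc (suc (m ℕ.+ n)) ×ₙ 1#)        ≡⟨ ≡.cong (λ k → - (k ×ₙ 1#)) (ℕ.+-suc (suc m) n) ⟨
    - ((suc m ℕ.+ suc n) ×ₙ 1#)          ≈⟨ -‿cong (×-homo-+ 1# (suc m) (suc n)) ⟩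
    - (suc m ×ₙ 1# + suc n ×ₙ 1#)        ≈⟨ ⁻¹-∙-comm _ _ ⟨
    - (suc m ×ₙ 1#) + - (suc n ×ₙ 1#)    ∎

  signed : Sign.Sign → Carrier → Carrier
  signed Sign.+ x = x
  signed Sign.- x = - x

  signed-cong : ∀ s {x y} → x ≈ y → signed s x ≈ signed s y
  signed-cong Sign.+ x≈y = x≈y
  signed-cong Sign.- x≈y = -‿cong x≈y

  signed-* : ∀ s t x y → signed (s Sign.* t) (x * y) ≈ signed s x * signed t y
  signed-* Sign.+ Sign.+ x y = refl
  signed-* Sign.+ Sign.- x y = -‿distribʳ-* x y
  signed-* Sign.- Sign.+ x y = -‿distribˡ-* x y
  signed-* Sign.- Sign.- x y = begin
    x * y          ≈⟨ -‿involutive _ ⟨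
    - - (x * y)    ≈⟨ -‿cong (-‿distribˡ-* x y) ⟩
    - (- x * y)    ≈⟨ -‿distribʳ-* (- x) y ⟩
    - x * - y      ∎

  fromℤ-◃ : ∀ s n → fromℤ (s ℤ.◃ n) ≈ signed s (n ×ₙ 1#)
  fromℤ-◃ Sign.+ zero    = refl
  fromℤ-◃ Sign.- zero    = sym -0#≈0#
  fromℤ-◃ Sign.+ (suc n) = refl
  fromℤ-◃ Sign.- (suc n) = refl

  fromℤ-signAbs : ∀ i → fromℤ i ≈ signed (ℤ.sign i) (ℤ.∣ i ∣ ×ₙ 1#)
  fromℤ-signAbs (+ zero)  = refl
  fromℤ-signAbs (+ suc n) = refl
  fromℤ-signAbs -[1+ n ]  = refl

  fromℤ-* : ∀ i j → fromℤ (i ℤ.* j) ≈ fromℤ i * fromℤ j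
  fromℤ-* i j = begin
    fromℤ (i ℤ.* j)                              ≈⟨ fromℤ-◃ (s Sign.* t) (∣i∣ ℕ.* ∣j∣) ⟩
    signed (s Sign.* t) ((∣i∣ ℕ.* ∣j∣) ×ₙ 1#)    ≈⟨ signed-cong (s Sign.* t) (×1-homo-* ∣i∣ ∣j∣) ⟩
    signed (s Sign.* t) (∣i∣ ×ₙ 1# * ∣j∣ ×ₙ 1#)  ≈⟨ signed-* s t _ _ ⟩
    signed s (∣i∣ ×ₙ 1#) * signed t (∣j∣ ×ₙ 1#)  ≈⟨ *-cong (fromℤ-signAbs i) (fromℤ-signAbs j) ⟨
    fromℤ i * fromℤ j                            ∎
    where
    s = ℤ.sign i
    t = ℤ.sign j
    ∣i∣ = ℤ.∣ i ∣
    ∣j∣ = ℤ.∣ j ∣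

  homomorphism : CommutativeRing.rawRing ℤ.+-*-commutativeRing ACR.-Raw-AlmostCommutative⟶ ACR.fromCommutativeRing R
  homomorphism = record
    { ⟦_⟧ = fromℤ ; +-homo = fromℤ-+ ; *-homo = fromℤ-* ; -‿homo = fromℤ-neg ; 0-homo = refl ; 1-homo = refl }

  fromℤ-≟ : ∀ i j → Maybe (fromℤ i ≈ fromℤ j)
  fromℤ-≟ i j with i ℤ.≟ j
  ... | yes ≡.refl = just refl
  ... | no _       = nothing

  open import Algebra.Solver.Ring _ _ homomorphism fromℤ-≟ public

  polynomialRawRing : ℕ → RawRing 0ℓ 0ℓ
  polynomialRawRing n = record
    { Carrier = Polynomial n ; _≈_ = _≡_
    ; _+_ = _:+_ ; _*_ = _:*_ ; -_ = :-_ ; 0# = con (+ 0) ; 1# = con (+ 1) }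

module RawSums {c ℓ} (R : RawRing c ℓ) where
  open RawRing R

  Σˡ : {A : Set} → List A → (A → Carrier) → Carrier
  Σˡ []       f = 0#
  Σˡ (a ∷ as) f = f a + Σˡ as f

  Σᵛ : {A : Set} → List A → (k : ℕ) → (Vec A k → Carrier) → Carrier
  Σᵛ as zero    f = f []
  Σᵛ as (suc k) f = Σˡ as (λ a → Σᵛ as k (λ v → f (a ∷ v)))

  ∏ : ∀ {ℓ′} {P : Set ℓ′} {A : Set} {k : ℕ} → (P → A → Carrier) → Vec P k → Vec A k → Carrier
  ∏ w []       []       = 1#
  ∏ w (p ∷ ps) (a ∷ v) = w p a * ∏ w ps v

bools : List Bool
bools = true ∷ false ∷ []

Pair Triple Quadruple : Set
Pair      = Bool × Bool
Triple    = Bool × Bool × Bool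
Quadruple = Bool × Bool × Bool × Bool

pairs : List Pair
pairs = cartesianProduct bools bools

triples : List Triple
triples = cartesianProduct bools pairs

quadruples : List Quadruple
quadruples = cartesianProduct bools triples

mixed : Quadruple → Pair
mixed (z , u , x , y) = y , (if z then x else u)

copies first second : Triple → Pair
copies (x , y , y′) = y , y′
first  (x , y , y′) = x , y
second (x , y , y′) = x , y′

mix : ∀ {k} → Vec Bool k → Vec Bool k → Vec Bool k → Vec Bool k
mix []       []       []       = []
mix (z ∷ zs) (x ∷ xs) (u ∷ us) = (if z then x else u) ∷ mix zs xs us

module _ {k : ℕ} (q : Vec Quadruple k) where
  zsOf usOf xsOf ysOf : Vec Bool k
  zsOf = Vec.map proj₁ q
  usOf = Vec.map proj₁ (Vec.map proj₂ q)
  xsOf = Vec.map proj₁ (Vec.map proj₂ (Vec.map proj₂ q))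
  ysOf = Vec.map proj₂ (Vec.map proj₂ (Vec.map proj₂ q))

map-mixed : ∀ {k} (q : Vec Quadruple k) →
  Vec.map proj₁ (Vec.map mixed q) ≡ ysOf q × Vec.map proj₂ (Vec.map mixed q) ≡ mix (zsOf q) (xsOf q) (usOf q)
map-mixed []      = ≡.refl , ≡.refl
map-mixed (p ∷ q) = ≡.cong (_ ∷_) (proj₁ (map-mixed q)) , ≡.cong (_ ∷_) (proj₂ (map-mixed q))

map-∘-cong : ∀ {A B C : Set} {k} (f₁ f₂ : B → C) (g₁ g₂ : A → B) → (∀ a → f₁ (g₁ a) ≡ f₂ (g₂ a)) →
  (v : Vec A k) → Vec.map f₁ (Vec.map g₁ v) ≡ Vec.map f₂ (Vec.map g₂ v)
map-∘-cong f₁ f₂ g₁ g₂ eq v = ≡.trans (≡.sym (map-∘ f₁ g₁ v)) (≡.trans (map-cong eq v) (map-∘ f₂ g₂ v))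

-- Stated over an arbitrary raw ring so that, instantiated at polynomial syntax, the one-coordinate
-- laws below become ring-solver problems.
module CoordinateWeights {c ℓ} (R : RawRing c ℓ) (½ : RawRing.Carrier R) where
  open RawRing R

  infixl 6 _-_
  _-_ : Carrier → Carrier → Carrier
  x - y = x + - y

  bit : Bool → Carrier
  bit b = if b then 1# else 0#

  bernoulli : Carrier → Bool → Carrier
  bernoulli a z = if z then a * a else 1# - a * a

  noise : Carrier → Bool → Bool → Carrier
  noise a x y = if x xor y then (1# - a) * ½ else (1# + a) * ½

  correlated : Carrier → Pair → Carrier
  correlated a (x , y) = ½ * noise a x y

  twoCopies : Carrier → Triple → Carrier
  twoCopies a (x , y , y′) = ½ * (noise a x y * noise a x y′)

  rerandomised : Carrier → Quadruple → Carrier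
  rerandomised a (z , u , x , y) = bernoulli a z * (½ * (½ * noise (bit z) x y))

table : {A : Set} → A → A → A → A → Pair → A
table t₁₁ t₁₀ t₀₁ t₀₀ (true  , true)  = t₁₁
table t₁₁ t₁₀ t₀₁ t₀₀ (true  , false) = t₁₀
table t₁₁ t₁₀ t₀₁ t₀₀ (false , true)  = t₀₁
table t₁₁ t₁₀ t₀₁ t₀₀ (false , false) = t₀₀

module CoordinateLaws {c ℓ} (R : CommutativeRing c ℓ) (½ : CommutativeRing.Carrier R) where
  open CommutativeRing R
  open IntegerCoefficients R using (solve; _:=_; _:+_; _:*_; Polynomial; polynomialRawRing)
  open import Relation.Binary.Reasoning.Setoid setoid
  open RawSums rawRing
  open CoordinateWeights rawRing ½

  private
    module Syntax {n} (h : Polynomial n) where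
      open RawSums (polynomialRawRing n) public
      open CoordinateWeights (polynomialRawRing n) h public

  -- Both sides are the law of a pair of a²-correlated bits, which agree with probability (1 + a²)/2.
  mixing-law : ∀ a (t : Pair → Carrier) →
    Σˡ quadruples (λ q → rerandomised a q * t (mixed q)) ≈ Σˡ triples (λ r → twoCopies a r * t (copies r))
  mixing-law a t = solve 6 identity refl a ½ (t (true , true)) (t (true , false)) (t (false , true)) (t (false , false))
    where
    identity : (a h t₁₁ t₁₀ t₀₁ t₀₀ : Polynomial 6) → Polynomial 6 × Polynomial 6
    identity a h t₁₁ t₁₀ t₀₁ t₀₀ =
      S.Σˡ quadruples (λ q → S.rerandomised a q :* τ (mixed q)) := S.Σˡ triples (λ r → S.twoCopies a r :* τ (copies r))
      where
      module S = Syntax h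
      τ = table t₁₁ t₁₀ t₀₁ t₀₀

  noise-distribution : ½ + ½ ≈ 1# → ∀ a → Σˡ bools (noise a true) ≈ 1#
  noise-distribution ½+½≈1 a = trans (solve 2 identity refl a ½) ½+½≈1
    where
    identity : (a h : Polynomial 2) → Polynomial 2 × Polynomial 2
    identity a h = S.Σˡ bools (S.noise a true) := h :+ h
      where module S = Syntax h

  marginal-law : ½ + ½ ≈ 1# → ∀ (π : Triple → Pair) → π ≡ first ⊎ π ≡ second → ∀ a (t : Pair → Carrier) →
    Σˡ triples (λ r → twoCopies a r * t (π r)) ≈ Σˡ pairs (λ p → correlated a p * t p)
  marginal-law ½+½≈1 π π-marginal a t = begin
    Σˡ triples (λ r → twoCopies a r * t (π r))                       ≈⟨ sum-out π-marginal ⟩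
    Σˡ pairs (λ p → correlated a p * t p) * Σˡ bools (noise a true)  ≈⟨ *-congˡ (noise-distribution ½+½≈1 a) ⟩
    Σˡ pairs (λ p → correlated a p * t p) * 1#                       ≈⟨ *-identityʳ _ ⟩
    Σˡ pairs (λ p → correlated a p * t p)                            ∎
    where
    identity : (Triple → Pair) → (a h t₁₁ t₁₀ t₀₁ t₀₀ : Polynomial 6) → Polynomial 6 × Polynomial 6
    identity π a h t₁₁ t₁₀ t₀₁ t₀₀ =
      S.Σˡ triples (λ r → S.twoCopies a r :* τ (π r))
        := S.Σˡ pairs (λ p → S.correlated a p :* τ p) :* S.Σˡ bools (S.noise a true)
      where
      module S = Syntax h
      τ = table t₁₁ t₁₀ t₀₁ t₀₀

    sum-out : π ≡ first ⊎ π ≡ second →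
      Σˡ triples (λ r → twoCopies a r * t (π r)) ≈ Σˡ pairs (λ p → correlated a p * t p) * Σˡ bools (noise a true)
    sum-out (inj₁ ≡.refl) = solve 6 (identity first)  refl a ½ (t (true , true)) (t (true , false)) (t (false , true)) (t (false , false))
    sum-out (inj₂ ≡.refl) = solve 6 (identity second) refl a ½ (t (true , true)) (t (true , false)) (t (false , true)) (t (false , false))

module SumProperties {c ℓ} (R : CommutativeRing c ℓ) where
  open CommutativeRing R hiding (zero)
  open RawSums rawRing
  open import Relation.Binary.Reasoning.Setoid setoid
  open import Algebra.Properties.CommutativeSemigroup +-commutativeSemigroup using (interchange)

  Σˡ-cong : {A : Set} (as : List A) {f g : A → Carrier} → (∀ a → f a ≈ g a) → Σˡ as f ≈ Σˡ as g
  Σˡ-cong []       f≈g = refl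
  Σˡ-cong (a ∷ as) f≈g = +-cong (f≈g a) (Σˡ-cong as f≈g)

  Σˡ-+ : {A : Set} (as : List A) (f g : A → Carrier) → Σˡ as (λ a → f a + g a) ≈ Σˡ as f + Σˡ as g
  Σˡ-+ []       f g = sym (+-identityʳ 0#)
  Σˡ-+ (a ∷ as) f g = trans (+-congˡ (Σˡ-+ as f g)) (interchange _ _ _ _)

  Σˡ-*ˡ : {A : Set} (as : List A) (x : Carrier) (f : A → Carrier) → x * Σˡ as f ≈ Σˡ as (λ a → x * f a)
  Σˡ-*ˡ []       x f = zeroʳ x
  Σˡ-*ˡ (a ∷ as) x f = trans (distribˡ x _ _) (+-congˡ (Σˡ-*ˡ as x f))

  Σˡ-0 : {A : Set} (as : List A) → Σˡ as (λ _ → 0#) ≈ 0#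
  Σˡ-0 []       = refl
  Σˡ-0 (a ∷ as) = trans (+-identityˡ _) (Σˡ-0 as)

  Σˡ-++ : {A : Set} (as bs : List A) (f : A → Carrier) → Σˡ (as ++ bs) f ≈ Σˡ as f + Σˡ bs f
  Σˡ-++ []       bs f = sym (+-identityˡ _)
  Σˡ-++ (a ∷ as) bs f = trans (+-congˡ (Σˡ-++ as bs f)) (sym (+-assoc _ _ _))

  Σˡ-map : {A B : Set} (h : A → B) (as : List A) (f : B → Carrier) → Σˡ (List.map h as) f ≈ Σˡ as (λ a → f (h a))
  Σˡ-map h []       f = refl
  Σˡ-map h (a ∷ as) f = +-congˡ (Σˡ-map h as f)

  Σˡ-comm : {A B : Set} (as : List A) (bs : List B) (f : A → B → Carrier) →
    Σˡ as (λ a → Σˡ bs (λ b → f a b)) ≈ Σˡ bs (λ b → Σˡ as (λ a → f a b))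
  Σˡ-comm []       bs f = sym (Σˡ-0 bs)
  Σˡ-comm (a ∷ as) bs f = trans (+-congˡ (Σˡ-comm as bs f)) (sym (Σˡ-+ bs (f a) _))

  Σˡ-cartesianProduct : {A B : Set} (as : List A) (bs : List B) (f : A × B → Carrier) →
    Σˡ (cartesianProduct as bs) f ≈ Σˡ as (λ a → Σˡ bs (λ b → f (a , b)))
  Σˡ-cartesianProduct []       bs f = refl
  Σˡ-cartesianProduct (a ∷ as) bs f = trans (Σˡ-++ (List.map (a ,_) bs) _ f)
    (+-cong (Σˡ-map (a ,_) bs f) (Σˡ-cartesianProduct as bs f))

  Σᵛ-cong : {A : Set} (as : List A) (k : ℕ) {f g : Vec A k → Carrier} → (∀ v → f v ≈ g v) → Σᵛ as k f ≈ Σᵛ as k g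
  Σᵛ-cong as zero    f≈g = f≈g []
  Σᵛ-cong as (suc k) f≈g = Σˡ-cong as (λ a → Σᵛ-cong as k (λ v → f≈g (a ∷ v)))

  Σᵛ-+ : {A : Set} (as : List A) (k : ℕ) (f g : Vec A k → Carrier) → Σᵛ as k (λ v → f v + g v) ≈ Σᵛ as k f + Σᵛ as k g
  Σᵛ-+ as zero    f g = refl
  Σᵛ-+ as (suc k) f g = trans (Σˡ-cong as (λ a → Σᵛ-+ as k _ _)) (Σˡ-+ as _ _)

  Σᵛ-*ˡ : {A : Set} (as : List A) (k : ℕ) (x : Carrier) (f : Vec A k → Carrier) → x * Σᵛ as k f ≈ Σᵛ as k (λ v → x * f v)
  Σᵛ-*ˡ as zero    x f = refl
  Σᵛ-*ˡ as (suc k) x f = trans (Σˡ-*ˡ as x _) (Σˡ-cong as (λ a → Σᵛ-*ˡ as k x _))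

  Σᵛ-Σˡ-comm : {A B : Set} (as : List A) (k : ℕ) (bs : List B) (f : Vec A k → B → Carrier) →
    Σᵛ as k (λ v → Σˡ bs (λ b → f v b)) ≈ Σˡ bs (λ b → Σᵛ as k (λ v → f v b))
  Σᵛ-Σˡ-comm as zero    bs f = refl
  Σᵛ-Σˡ-comm as (suc k) bs f = trans (Σˡ-cong as (λ a → Σᵛ-Σˡ-comm as k bs (λ v → f (a ∷ v))))
    (Σˡ-comm as bs _)

  Σᵛ-zip : {A B : Set} (as : List A) (bs : List B) (k : ℕ) (f : Vec A k → Vec B k → Carrier) →
    Σᵛ as k (λ v → Σᵛ bs k (λ w → f v w)) ≈ Σᵛ (cartesianProduct as bs) k (λ p → f (Vec.map proj₁ p) (Vec.map proj₂ p))
  Σᵛ-zip as bs zero    f = refl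
  Σᵛ-zip as bs (suc k) f = begin
    Σˡ as (λ a → Σᵛ as k (λ v → Σˡ bs (λ b → Σᵛ bs k (λ w → f (a ∷ v) (b ∷ w)))))
      ≈⟨ Σˡ-cong as (λ a → Σᵛ-Σˡ-comm as k bs _) ⟩
    Σˡ as (λ a → Σˡ bs (λ b → Σᵛ as k (λ v → Σᵛ bs k (λ w → f (a ∷ v) (b ∷ w)))))
      ≈⟨ Σˡ-cong as (λ a → Σˡ-cong bs (λ b → Σᵛ-zip as bs k _)) ⟩
    Σˡ as (λ a → Σˡ bs (λ b → Σᵛ (cartesianProduct as bs) k (λ p → f (a ∷ Vec.map proj₁ p) (b ∷ Vec.map proj₂ p))))
      ≈⟨ Σˡ-cartesianProduct as bs _ ⟨
    Σᵛ (cartesianProduct as bs) (suc k) (λ p → f (Vec.map proj₁ p) (Vec.map proj₂ p)) ∎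

  Σᵛ-∏-head : ∀ {ℓ′} {P : Set ℓ′} {A X : Set} (as : List A) (w : P → A → Carrier) (φ : A → X)
    (p : P) {k : ℕ} (ps : Vec P k) (T : Vec X (suc k) → Carrier) →
    Σᵛ as (suc k) (λ v → ∏ w (p ∷ ps) v * T (Vec.map φ v)) ≈
    Σˡ as (λ a → w p a * Σᵛ as k (λ v → ∏ w ps v * T (φ a ∷ Vec.map φ v)))
  Σᵛ-∏-head as w φ p {k} ps T =
    Σˡ-cong as (λ a → trans (Σᵛ-cong as k (λ v → *-assoc _ _ _)) (sym (Σᵛ-*ˡ as k (w p a) _)))

  Σᵛ-∏-law : ∀ {ℓ′} {P : Set ℓ′} {A B X : Set} (as : List A) (bs : List B) (wA : P → A → Carrier) (wB : P → B → Carrier)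
    (φ : A → X) (ψ : B → X) →
    (∀ p (t : X → Carrier) → Σˡ as (λ a → wA p a * t (φ a)) ≈ Σˡ bs (λ b → wB p b * t (ψ b))) →
    ∀ {k} (ps : Vec P k) (T : Vec X k → Carrier) →
    Σᵛ as k (λ v → ∏ wA ps v * T (Vec.map φ v)) ≈ Σᵛ bs k (λ v → ∏ wB ps v * T (Vec.map ψ v))
  Σᵛ-∏-law as bs wA wB φ ψ law []               T = refl
  Σᵛ-∏-law {X = X} as bs wA wB φ ψ law {suc k} (p ∷ ps) T = begin
    Σᵛ as (suc k) (λ v → ∏ wA (p ∷ ps) v * T (Vec.map φ v))
      ≈⟨ Σᵛ-∏-head as wA φ p ps T ⟩
    Σˡ as (λ a → wA p a * Σᵛ as k (λ v → ∏ wA ps v * T (φ a ∷ Vec.map φ v)))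
      ≈⟨ Σˡ-cong as (λ a → *-congˡ (Σᵛ-∏-law as bs wA wB φ ψ law ps (λ v → T (φ a ∷ v)))) ⟩
    Σˡ as (λ a → wA p a * rest (φ a))
      ≈⟨ law p rest ⟩
    Σˡ bs (λ b → wB p b * rest (ψ b))
      ≈⟨ Σᵛ-∏-head bs wB ψ p ps T ⟨
    Σᵛ bs (suc k) (λ v → ∏ wB (p ∷ ps) v * T (Vec.map ψ v)) ∎
    where
    rest : X → Carrier
    rest x = Σᵛ bs k (λ v → ∏ wB ps v * T (x ∷ Vec.map ψ v))

module OrderedFieldProperties {c ℓ₁ ℓ₂} (F : OrderedField c ℓ₁ ℓ₂) where
  open OrderedField F hiding (zero)
  open Prob F using (½)
  open IntegerCoefficients commutativeRing using (solve; _:=_; _:+_; _:*_; _:-_; :-_; con)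
  open RawSums rawRing
  open import Relation.Binary.Reasoning.Setoid setoid
  module ≤ = IsTotalOrder isTotalOrder

  poset : Poset c ℓ₁ ℓ₂
  poset = record { isPartialOrder = ≤.isPartialOrder }

  +-mono-≤ : ∀ {a b x y} → a ≤ b → x ≤ y → (a + x) ≤ (b + y)
  +-mono-≤ {a} {b} {x} {y} a≤b x≤y = ≤.trans (+-monoʳ-≤ord x a≤b)
    (≤.trans (≤.reflexive (+-comm b x)) (≤.trans (+-monoʳ-≤ord b x≤y) (≤.reflexive (+-comm y b))))

  x≤y⇒0≤y-x : ∀ {x y} → x ≤ y → 0# ≤ (y - x)
  x≤y⇒0≤y-x {x} p = ≤.trans (≤.reflexive (sym (-‿inverseʳ x))) (+-monoʳ-≤ord (- x) p)

  0≤y-x⇒x≤y : ∀ {x y} → 0# ≤ (y - x) → x ≤ y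
  0≤y-x⇒x≤y {x} {y} p = ≤.trans (≤.reflexive (sym (+-identityˡ x)))
    (≤.trans (+-monoʳ-≤ord x p) (≤.reflexive (solve 2 (λ x y → y :- x :+ x := y) refl x y)))

  x≤0⇒0≤-x : ∀ {x} → x ≤ 0# → 0# ≤ (- x)
  x≤0⇒0≤-x p = ≤.trans (x≤y⇒0≤y-x p) (≤.reflexive (+-identityˡ _))

  0≤x*x : ∀ x → 0# ≤ (x * x)
  0≤x*x x with ≤.total 0# x
  ... | inj₁ 0≤x = *-nonneg 0≤x 0≤x
  ... | inj₂ x≤0 = ≤.trans (*-nonneg 0≤-x 0≤-x) (≤.reflexive (solve 1 (λ x → :- x :* :- x := x :* x) refl x))
    where 0≤-x = x≤0⇒0≤-x x≤0

  0≤1 : 0# ≤ 1#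
  0≤1 = ≤.trans (0≤x*x 1#) (≤.reflexive (*-identityˡ 1#))

  *-monoˡ-≤ : ∀ {z x y} → 0# ≤ z → x ≤ y → (z * x) ≤ (z * y)
  *-monoˡ-≤ {z} {x} {y} 0≤z x≤y = 0≤y-x⇒x≤y (≤.trans (*-nonneg 0≤z (x≤y⇒0≤y-x x≤y))
    (≤.reflexive (solve 3 (λ z x y → z :* (y :- x) := z :* y :- z :* x) refl z x y)))

  0≤x+x : ∀ {x} → 0# ≤ x → 0# ≤ (x + x)
  0≤x+x 0≤x = ≤.trans (≤.reflexive (sym (+-identityʳ 0#))) (+-mono-≤ 0≤x 0≤x)

  1≤1+1 : 1# ≤ (1# + 1#)
  1≤1+1 = ≤.trans (≤.reflexive (sym (+-identityʳ 1#))) (+-mono-≤ (≤.reflexive refl) 0≤1)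

  1+1≉0 : ¬ (1# + 1# ≈ 0#)
  1+1≉0 1+1≈0 = 0≉1 (≤.antisym 0≤1 (≤.trans 1≤1+1 (≤.reflexive 1+1≈0)))

  [1+1]*½≈1 : (1# + 1#) * ½ ≈ 1#
  [1+1]*½≈1 = ⁻¹-inverse (1# + 1#) 1+1≉0

  ½+½≈1 : ½ + ½ ≈ 1#
  ½+½≈1 = trans (solve 1 (λ h → h :+ h := (con (+ 1) :+ con (+ 1)) :* h) refl ½) [1+1]*½≈1

  0≤½ : 0# ≤ ½
  0≤½ = ≤.trans (*-nonneg (0≤x*x ½) (0≤x+x 0≤1)) (≤.reflexive ½*½*[1+1]≈½)
    where
    ½*½*[1+1]≈½ : (½ * ½) * (1# + 1#) ≈ ½
    ½*½*[1+1]≈½ = begin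
      (½ * ½) * (1# + 1#)  ≈⟨ *-assoc ½ ½ _ ⟩
      ½ * (½ * (1# + 1#))  ≈⟨ *-congˡ (trans (*-comm ½ _) [1+1]*½≈1) ⟩
      ½ * 1#               ≈⟨ *-identityʳ ½ ⟩
      ½                    ∎

  Σˡ-mono-≤ : {A : Set} (as : List A) {f g : A → Carrier} → (∀ a → f a ≤ g a) → Σˡ as f ≤ Σˡ as g
  Σˡ-mono-≤ []       f≤g = ≤.reflexive refl
  Σˡ-mono-≤ (a ∷ as) f≤g = +-mono-≤ (f≤g a) (Σˡ-mono-≤ as f≤g)

  Σᵛ-mono-≤ : {A : Set} (as : List A) (k : ℕ) {f g : Vec A k → Carrier} → (∀ v → f v ≤ g v) → Σᵛ as k f ≤ Σᵛ as k g
  Σᵛ-mono-≤ as zero    f≤g = f≤g []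
  Σᵛ-mono-≤ as (suc k) f≤g = Σˡ-mono-≤ as (λ a → Σᵛ-mono-≤ as k (λ v → f≤g (a ∷ v)))

  ∏-nonneg : ∀ {ℓ′ ℓ″} {P : Set ℓ′} {A : Set} {k : ℕ} (Q : P → Set ℓ″) (w : P → A → Carrier) →
    (∀ {p} → Q p → ∀ a → 0# ≤ w p a) → (ps : Vec P k) → (∀ i → Q (lookup ps i)) → ∀ v → 0# ≤ ∏ w ps v
  ∏-nonneg Q w w≥0 []       Qps []      = 0≤1
  ∏-nonneg Q w w≥0 (p ∷ ps) Qps (a ∷ v) = *-nonneg (w≥0 (Qps Fin.zero) a) (∏-nonneg Q w w≥0 ps (λ i → Qps (Fin.suc i)) v)

module Averaging {c ℓ₁ ℓ₂} (F : OrderedField c ℓ₁ ℓ₂) where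
  open OrderedField F hiding (zero)
  open Prob F
  open IntegerCoefficients commutativeRing using (solve; _:=_; _:+_; _:*_; _:-_; :-_; con)
  open RawSums rawRing
  open CoordinateWeights rawRing ½ hiding (_-_)
  open CoordinateLaws commutativeRing ½
  open SumProperties commutativeRing
  open OrderedFieldProperties F
  open import Relation.Binary.Reasoning.PartialOrder poset

  Bounded : Carrier → Set ℓ₂
  Bounded a = ((- 1#) ≤ a) × (a ≤ 1#)

  bounded⇒0≤1+a : ∀ {a} → Bounded a → 0# ≤ (1# + a)
  bounded⇒0≤1+a {a} (-1≤a , _) =
    ≤.trans (x≤y⇒0≤y-x -1≤a) (≤.reflexive (solve 1 (λ a → a :- (:- con (+ 1)) := con (+ 1) :+ a) refl a))

  bounded⇒0≤1-a : ∀ {a} → Bounded a → 0# ≤ (1# - a)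
  bounded⇒0≤1-a (_ , a≤1) = x≤y⇒0≤y-x a≤1

  noise-nonneg : ∀ {a} → Bounded a → ∀ x y → 0# ≤ noise a x y
  noise-nonneg a∈I x y with x xor y
  ... | true  = *-nonneg (bounded⇒0≤1-a a∈I) 0≤½
  ... | false = *-nonneg (bounded⇒0≤1+a a∈I) 0≤½

  bernoulli-nonneg : ∀ {a} → Bounded a → ∀ z → 0# ≤ bernoulli a z
  bernoulli-nonneg {a} a∈I true  = 0≤x*x a
  bernoulli-nonneg {a} a∈I false = ≤.trans (*-nonneg (bounded⇒0≤1-a a∈I) (bounded⇒0≤1+a a∈I))
    (≤.reflexive (solve 1 (λ a → (con (+ 1) :- a) :* (con (+ 1) :+ a) := con (+ 1) :- a :* a) refl a))

  twoCopies-nonneg : ∀ {a} → Bounded a → ∀ r → 0# ≤ twoCopies a r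
  twoCopies-nonneg a∈I (x , y , y′) = *-nonneg 0≤½ (*-nonneg (noise-nonneg a∈I x y) (noise-nonneg a∈I x y′))

  berProb≡∏ : ∀ {k} (α : Vec Carrier k) z → berProb α z ≡ ∏ bernoulli α z
  berProb≡∏ []      []      = ≡.refl
  berProb≡∏ (a ∷ α) (z ∷ v) = ≡.cong (λ s → bernoulli a z * s) (berProb≡∏ α v)

  berProb-nonneg : ∀ {k} (α : Vec Carrier k) → (∀ i → Bounded (lookup α i)) → ∀ z → 0# ≤ berProb α z
  berProb-nonneg α α∈I z =
    ≤.trans (∏-nonneg Bounded bernoulli bernoulli-nonneg α α∈I z) (≤.reflexive (reflexive (≡.sym (berProb≡∏ α z))))

  jointProb≡∏ : ∀ {k} (β : Vec Carrier k) p → jointProb β (Vec.map proj₁ p) (Vec.map proj₂ p) ≡ ∏ correlated β p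
  jointProb≡∏ []      []      = ≡.refl
  jointProb≡∏ (b ∷ β) (p ∷ ps) = ≡.cong (λ s → correlated b p * s) (jointProb≡∏ β ps)

  sumL≡Σˡ : {A : Set} (as : List A) (f : A → Carrier) → sumL (List.map f as) ≡ Σˡ as f
  sumL≡Σˡ []       f = ≡.refl
  sumL≡Σˡ (a ∷ as) f = ≡.cong (λ s → f a + s) (sumL≡Σˡ as f)

  Σ≈Σᵛ : ∀ k (f : Vec Bool k → Carrier) → Σ[ k ] f ≈ Σᵛ bools k f
  Σ≈Σᵛ k f = trans (reflexive (sumL≡Σˡ (allVecs k) f)) (Σˡ-allVecs k f)
    where
    Σˡ-allVecs : ∀ k (f : Vec Bool k → Carrier) → Σˡ (allVecs k) f ≈ Σᵛ bools k f
    Σˡ-allVecs zero    f = +-identityʳ _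
    Σˡ-allVecs (suc k) f = begin-equality
      Σˡ (List.map (true ∷_) (allVecs k) ++ List.map (false ∷_) (allVecs k)) f
        ≈⟨ Σˡ-++ (List.map (true ∷_) (allVecs k)) _ f ⟩
      Σˡ (List.map (true ∷_) (allVecs k)) f + Σˡ (List.map (false ∷_) (allVecs k)) f
        ≈⟨ +-cong (Σˡ-map (true ∷_) (allVecs k) f) (Σˡ-map (false ∷_) (allVecs k) f) ⟩
      Σˡ (allVecs k) (λ v → f (true ∷ v)) + Σˡ (allVecs k) (λ v → f (false ∷ v))
        ≈⟨ +-cong (Σˡ-allVecs k _) (trans (Σˡ-allVecs k _) (sym (+-identityʳ _))) ⟩
      Σᵛ bools (suc k) f ∎

  uniform : ∀ {k} → Vec Bool k → Carrier
  uniform []      = 1#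
  uniform (_ ∷ u) = ½ * uniform u

  uniform-nonneg : ∀ {k} (u : Vec Bool k) → 0# ≤ uniform u
  uniform-nonneg []      = 0≤1
  uniform-nonneg (_ ∷ u) = *-nonneg 0≤½ (uniform-nonneg u)

  Σᵛ-uniform : ∀ k → Σᵛ bools k uniform ≈ 1#
  Σᵛ-uniform zero    = refl
  Σᵛ-uniform (suc k) = begin-equality
    Σᵛ bools k (λ v → ½ * uniform v) + (Σᵛ bools k (λ v → ½ * uniform v) + 0#) ≈⟨ +-congˡ (+-identityʳ _) ⟩
    Σᵛ bools k (λ v → ½ * uniform v) + Σᵛ bools k (λ v → ½ * uniform v)        ≈⟨ +-cong half half ⟩
    ½ + ½                                                                      ≈⟨ ½+½≈1 ⟩
    1#                                                                         ∎
    where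
    half : Σᵛ bools k (λ v → ½ * uniform v) ≈ ½
    half = trans (sym (Σᵛ-*ˡ bools k ½ uniform)) (trans (*-congˡ (Σᵛ-uniform k)) (*-identityʳ ½))

  ≤-mean : ∀ k {e} (f : Vec Bool k → Carrier) → (∀ u → e ≤ f u) → e ≤ Σᵛ bools k (λ u → uniform u * f u)
  ≤-mean k {e} f e≤f = begin
    e                                     ≈⟨ *-identityʳ e ⟨
    e * 1#                                ≈⟨ *-congˡ (Σᵛ-uniform k) ⟨
    e * Σᵛ bools k uniform                ≈⟨ Σᵛ-*ˡ bools k e uniform ⟩
    Σᵛ bools k (λ u → e * uniform u)      ≤⟨ Σᵛ-mono-≤ bools k e*u≤u*f ⟩
    Σᵛ bools k (λ u → uniform u * f u)    ∎
    where
    e*u≤u*f : ∀ u → (e * uniform u) ≤ (uniform u * f u)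
    e*u≤u*f u = ≤.trans (≤.reflexive (*-comm e _)) (*-monoˡ-≤ (uniform-nonneg u) (e≤f u))

  rerandomised-weight : ∀ {k} (α : Vec Carrier k) (q : Vec Quadruple k) →
    berProb α (zsOf q) * (uniform (usOf q) * jointProb (toVec (zsOf q)) (xsOf q) (ysOf q)) ≈ ∏ rerandomised α q
  rerandomised-weight []      []      = trans (*-identityˡ _) (*-identityˡ _)
  rerandomised-weight (a ∷ α) (p ∷ q) = trans (rearrange _ _ ½ _ _ _) (*-congˡ (rerandomised-weight α q))
    where
    rearrange : ∀ b B h U n J → (b * B) * ((h * U) * ((h * n) * J)) ≈ (b * (h * (h * n))) * (B * (U * J))
    rearrange = solve 6 (λ b B h U n J → (b :* B) :* ((h :* U) :* ((h :* n) :* J)) := (b :* (h :* (h :* n))) :* (B :* (U :* J))) refl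

  Σᵛ-quadruples : ∀ {k} (f : Vec Bool k → Vec Bool k → Vec Bool k → Vec Bool k → Carrier) →
    Σᵛ bools k (λ z → Σᵛ bools k (λ u → Σᵛ bools k (λ x → Σᵛ bools k (λ y → f z u x y)))) ≈
    Σᵛ quadruples k (λ q → f (zsOf q) (usOf q) (xsOf q) (ysOf q))
  Σᵛ-quadruples {k} f =
    trans (Σᵛ-cong bools k (λ z → trans (Σᵛ-cong bools k (λ u → Σᵛ-zip bools bools k _)) (Σᵛ-zip bools pairs k _)))
          (Σᵛ-zip bools triples k _)

  indicator-nonneg : ∀ b → 0# ≤ indicator b
  indicator-nonneg true  = 0≤1
  indicator-nonneg false = ≤.reflexive refl

  indicator-triangle : ∀ a b c → indicator (a xor b) ≤ (indicator (a xor c) + indicator (b xor c))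
  indicator-triangle true  true  c     = 0≤x+x (indicator-nonneg (true xor c))
  indicator-triangle false false c     = 0≤x+x (indicator-nonneg (false xor c))
  indicator-triangle true  false true  = ≤.reflexive (sym (+-identityˡ 1#))
  indicator-triangle true  false false = ≤.reflexive (sym (+-identityʳ 1#))
  indicator-triangle false true  true  = ≤.reflexive (sym (+-identityʳ 1#))
  indicator-triangle false true  false = ≤.reflexive (sym (+-identityˡ 1#))

  module _ {k : ℕ} (g : Vec Bool k → Bool) where

    disagreesOn : Vec Pair k → Carrier
    disagreesOn v = indicator (g (Vec.map proj₁ v) xor g (Vec.map proj₂ v))

    mistakeOf : (Vec Bool k → Bool) → Vec Pair k → Carrier
    mistakeOf h v = indicator (g (Vec.map proj₂ v) xor h (Vec.map proj₁ v))

    disagree-Σᵛ : ∀ β h → disagree β g h ≈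
      Σᵛ bools k (λ x → Σᵛ bools k (λ y → jointProb β x y * indicator (g y xor h x)))
    disagree-Σᵛ β h = trans (Σ≈Σᵛ k _) (Σᵛ-cong bools k (λ x → Σ≈Σᵛ k _))

    disagree-Σᵛ-pairs : ∀ β h → disagree β g h ≈ Σᵛ pairs k (λ p → ∏ correlated β p * mistakeOf h p)
    disagree-Σᵛ-pairs β h = begin-equality
      disagree β g h                                                                   ≈⟨ disagree-Σᵛ β h ⟩
      Σᵛ bools k (λ x → Σᵛ bools k (λ y → jointProb β x y * indicator (g y xor h x))) ≈⟨ Σᵛ-zip bools bools k _ ⟩
      Σᵛ pairs k (λ p → jointProb β (Vec.map proj₁ p) (Vec.map proj₂ p) * mistakeOf h p)
        ≈⟨ Σᵛ-cong pairs k (λ p → *-congʳ (reflexive (jointProb≡∏ β p))) ⟩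
      Σᵛ pairs k (λ p → ∏ correlated β p * mistakeOf h p)                            ∎

    copies-triangle : ∀ h r →
      disagreesOn (Vec.map copies r) ≤ (mistakeOf h (Vec.map first r) + mistakeOf h (Vec.map second r))
    copies-triangle h r
      rewrite map-∘-cong proj₁ proj₂ copies first (λ _ → ≡.refl) r
            | map-∘-cong proj₂ proj₂ copies second (λ _ → ≡.refl) r
            | map-∘-cong proj₁ proj₁ second first (λ _ → ≡.refl) r
      = indicator-triangle (g (Vec.map proj₂ (Vec.map first r))) (g (Vec.map proj₂ (Vec.map second r)))
                           (h (Vec.map proj₁ (Vec.map first r)))

    twoCopies-disagreement≤ : ∀ α → (∀ i → Bounded (lookup α i)) → ∀ h →
      Σᵛ triples k (λ r → ∏ twoCopies α r * disagreesOn (Vec.map copies r)) ≤ (disagree α g h + disagree α g h)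
    twoCopies-disagreement≤ α α∈I h = begin
      Σᵛ triples k (λ r → ∏ twoCopies α r * disagreesOn (Vec.map copies r))
        ≤⟨ Σᵛ-mono-≤ triples k triangle ⟩
      Σᵛ triples k (λ r → weighted first r + weighted second r)
        ≈⟨ Σᵛ-+ triples k _ _ ⟩
      Σᵛ triples k (weighted first) + Σᵛ triples k (weighted second)
        ≈⟨ +-cong (marginal first (inj₁ ≡.refl)) (marginal second (inj₂ ≡.refl)) ⟩
      disagree α g h + disagree α g h ∎
      where
      weighted : (Triple → Pair) → Vec Triple k → Carrier
      weighted π r = ∏ twoCopies α r * mistakeOf h (Vec.map π r)

      triangle : ∀ r → (∏ twoCopies α r * disagreesOn (Vec.map copies r)) ≤ (weighted first r + weighted second r)
      triangle r = ≤.trans (*-monoˡ-≤ (∏-nonneg Bounded twoCopies twoCopies-nonneg α α∈I r) (copies-triangle h r))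
                           (≤.reflexive (distribˡ _ _ _))

      marginal : ∀ π → π ≡ first ⊎ π ≡ second → Σᵛ triples k (weighted π) ≈ disagree α g h
      marginal π π-marginal = begin-equality
        Σᵛ triples k (weighted π)
          ≈⟨ Σᵛ-∏-law triples pairs twoCopies correlated π id (marginal-law ½+½≈1 π π-marginal) α (mistakeOf h) ⟩
        Σᵛ pairs k (λ p → ∏ correlated α p * mistakeOf h (Vec.map id p))
          ≈⟨ Σᵛ-cong pairs k (λ p → *-congˡ (reflexive (≡.cong (mistakeOf h) (map-id p)))) ⟩
        Σᵛ pairs k (λ p → ∏ correlated α p * mistakeOf h p)
          ≈⟨ disagree-Σᵛ-pairs α h ⟨
        disagree α g h ∎

    rerandomisedError : Vec Bool k → Vec Bool k → Carrier
    rerandomisedError z u = disagree (toVec z) g (λ x → g (mix z x u))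

    expected-error≤ : ∀ α → (∀ i → Bounded (lookup α i)) →
      ∀ (ez : Vec Bool k → Carrier) → (∀ z → IsError (toVec z) g (ez z)) →
      Σ[ k ] (λ z → berProb α z * ez z) ≤
      Σᵛ bools k (λ z → berProb α z * Σᵛ bools k (λ u → uniform u * rerandomisedError z u))
    expected-error≤ α α∈I ez ez-error = begin
      Σ[ k ] (λ z → berProb α z * ez z)     ≈⟨ Σ≈Σᵛ k _ ⟩
      Σᵛ bools k (λ z → berProb α z * ez z) ≤⟨ Σᵛ-mono-≤ bools k (λ z → *-monoˡ-≤ (berProb-nonneg α α∈I z)
                                                  (≤-mean k (rerandomisedError z) (λ u → proj₂ (ez-error z) _))) ⟩
      Σᵛ bools k (λ z → berProb α z * Σᵛ bools k (λ u → uniform u * rerandomisedError z u)) ∎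

    rerandomised-expansion : ∀ α →
      Σᵛ bools k (λ z → berProb α z * Σᵛ bools k (λ u → uniform u * rerandomisedError z u)) ≈
      Σᵛ quadruples k (λ q → ∏ rerandomised α q * disagreesOn (Vec.map mixed q))
    rerandomised-expansion α = begin-equality
      Σᵛ bools k (λ z → berProb α z * Σᵛ bools k (λ u → uniform u * rerandomisedError z u))
        ≈⟨ Σᵛ-cong bools k (λ z → *-congˡ (Σᵛ-cong bools k (λ u → trans (*-congˡ (disagree-Σᵛ (toVec z) _)) (Σᵛ²-*ˡ _ _)))) ⟩
      Σᵛ bools k (λ z → berProb α z * Σᵛ bools k (λ u → Σᵛ bools k (λ x → Σᵛ bools k (λ y → uniform u * summand z u x y))))
        ≈⟨ Σᵛ-cong bools k (λ z → trans (Σᵛ-*ˡ bools k _ _) (Σᵛ-cong bools k (λ u → Σᵛ²-*ˡ _ _))) ⟩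
      Σᵛ bools k (λ z → Σᵛ bools k (λ u → Σᵛ bools k (λ x → Σᵛ bools k (λ y → term z u x y))))
        ≈⟨ Σᵛ-quadruples term ⟩
      Σᵛ quadruples k (λ q → term (zsOf q) (usOf q) (xsOf q) (ysOf q))
        ≈⟨ Σᵛ-cong quadruples k regroup ⟩
      Σᵛ quadruples k (λ q → ∏ rerandomised α q * disagreesOn (Vec.map mixed q)) ∎
      where
      summand : Vec Bool k → Vec Bool k → Vec Bool k → Vec Bool k → Carrier
      summand z u x y = jointProb (toVec z) x y * indicator (g y xor g (mix z x u))

      term : Vec Bool k → Vec Bool k → Vec Bool k → Vec Bool k → Carrier
      term z u x y = berProb α z * (uniform u * summand z u x y)

      Σᵛ²-*ˡ : ∀ w (f : Vec Bool k → Vec Bool k → Carrier) →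
        w * Σᵛ bools k (λ x → Σᵛ bools k (λ y → f x y)) ≈ Σᵛ bools k (λ x → Σᵛ bools k (λ y → w * f x y))
      Σᵛ²-*ˡ w f = trans (Σᵛ-*ˡ bools k w _) (Σᵛ-cong bools k (λ x → Σᵛ-*ˡ bools k w _))

      regroup : ∀ q → term (zsOf q) (usOf q) (xsOf q) (ysOf q) ≈ ∏ rerandomised α q * disagreesOn (Vec.map mixed q)
      regroup q = trans (trans (*-congˡ (sym (*-assoc _ _ _))) (sym (*-assoc _ _ _)))
                        (*-cong (rerandomised-weight α q) (reflexive (≡.sym disagreesOn-mixed)))
        where
        disagreesOn-mixed : disagreesOn (Vec.map mixed q) ≡ indicator (g (ysOf q) xor g (mix (zsOf q) (xsOf q) (usOf q)))
        disagreesOn-mixed = ≡.cong₂ (λ y w → indicator (g y xor g w)) (proj₁ (map-mixed q)) (proj₂ (map-mixed q))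

claim2 : ∀ {c ℓ₁ ℓ₂} (F : OrderedField c ℓ₁ ℓ₂) →
    let open OrderedField F
        open Prob F
    in
    ∀ (k : ℕ) (g : Vec Bool k → Bool) (α : Vec Carrier k) →
    (∀ (i : Fin k) → ((- 1#) ≤ lookup α i) × (lookup α i ≤ 1#)) →
    ∀ (eα : Carrier) → IsError α g eα →
    ∀ (ez : Vec Bool k → Carrier) → (∀ z → IsError (toVec z) g (ez z)) →
    Σ[ k ] (λ z → berProb α z * ez z) ≤ ((1# + 1#) * eα)
claim2 F k g α α∈I eα ((h , eα≈disagree) , _) ez ez-error = begin
  Σ[ k ] (λ z → berProb α z * ez z)
    ≤⟨ expected-error≤ g α α∈I ez ez-error ⟩
  Σᵛ bools k (λ z → berProb α z * Σᵛ bools k (λ u → uniform u * rerandomisedError g z u))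
    ≈⟨ rerandomised-expansion g α ⟩
  Σᵛ quadruples k (λ q → ∏ rerandomised α q * disagreesOn g (Vec.map mixed q))
    ≈⟨ Σᵛ-∏-law quadruples triples rerandomised twoCopies mixed copies mixing-law α (disagreesOn g) ⟩
  Σᵛ triples k (λ r → ∏ twoCopies α r * disagreesOn g (Vec.map copies r))
    ≤⟨ twoCopies-disagreement≤ g α α∈I h ⟩
  disagree α g h + disagree α g h
    ≈⟨ +-cong eα≈disagree eα≈disagree ⟨
  eα + eα
    ≈⟨ trans (distribʳ eα 1# 1#) (+-cong (*-identityˡ eα) (*-identityˡ eα)) ⟨
  (1# + 1#) * eα ∎
  where
  open OrderedField F hiding (zero)
  open Prob F
  open RawSums rawRing
  open CoordinateWeights rawRing ½ hiding (_-_)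
  open CoordinateLaws commutativeRing ½
  open SumProperties commutativeRing
  open OrderedFieldProperties F using (poset)
  open Averaging F
  open import Relation.Binary.Reasoning.PartialOrder poset
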